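{- Let $\mathbf{x}=(x_1,x_2,\dots)$ and $\mathbf{y}=(y_1,y_2,\dots)$ be elements of $\ell^1(\mathbb{Z}_2)$. If $$\sum_{j\ge1}\frac{(\mathbf{x}+\mathbf{y})_j}{j+1}=\sum_{j\ge1}\frac{x_j}{j+1}+\sum_{j\ge1}\frac{y_j}{j+1},$$ then the point $(a,b)$ with $a=\sum_{j\ge1}x_j2^{ -j}$ and $b=\sum_{j\ge1}y_j2^{ -j}$ (i.e. $a=[0.x_1x_2\dots]_2$, $b=[0.y_1y_2\dots]_2$) lies in the Sierpinski triangle $S_T$.
   Context: $\ell^1(\mathbb{Z}_2)$ is the set of sequences with entries in $\{0,1\}$ having only finitely many nonzero entries, with addition componentwise modulo $2$. The Sierpinski triangle $S_T$ is defined as follows: $T_0=\{(x,y)\in[0,1]\times[0,1]: 0\le x+y\le1\}$ (the closed triangle with vertices $(0,0),(1,0),(0,1)$); $S_0=T_0$; for $j\ge0$, letting $S_j'=\tfrac12 S_j$ be the scaled copy of $S_j$, $v=(\tfrac12,0)$, $w=(0,\tfrac12)$, set $S_{j+1}=S_j'\cup(S_j'+v)\cup(S_j'+w)$; and $S_T=\bigcap_{j\ge0}S_j$. -}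

module Defs where

open import Data.Bool using (Bool; true; false; _xor_; if_then_else_)
open import Data.Nat as ℕ using (ℕ; zero; suc; _⊔_)
open import Data.Nat.Properties using (m⊔n≤o⇒m≤o; m⊔n≤o⇒n≤o)
open import Data.Integer using (+_)
open import Data.Rational using (ℚ; 0ℚ; 1ℚ; ½; _+_; _*_; _/_; _≤_)
open import Data.Product using (Σ; ∃; _×_; _,_)
open import Data.Sum using (_⊎_)
open import Relation.Binary.PropositionalEquality using (_≡_; refl; cong₂)

-- ℓ¹(ℤ₂): 0/1-sequences (Bool, true = 1) with finitely many nonzero entries.
-- Index convention: seq i is the paper's entry x_{i+1}  (i = 0,1,2,...).
record ℓ¹ℤ₂ : Set where
  field
    seq     : ℕ → Bool
    bound   : ℕ
    finite  : ∀ i → bound ℕ.≤ i → seq i ≡ false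
open ℓ¹ℤ₂ public

_⊕_ : ℓ¹ℤ₂ → ℓ¹ℤ₂ → ℓ¹ℤ₂
x ⊕ y = record
  { seq = λ i → seq x i xor seq y i
  ; bound = bound x ⊔ bound y
  ; finite = λ i le → cong₂ _xor_
      (finite x i (m⊔n≤o⇒m≤o (bound x) (bound y) le))
      (finite y i (m⊔n≤o⇒n≤o (bound x) (bound y) le)) ▸ refl }
  where
    _▸_ : ∀ {a b : Bool} → a ≡ b → b ≡ false → a ≡ false
    refl ▸ q = q

bit : Bool → ℚ
bit b = if b then 1ℚ else 0ℚ

Σ< : ℕ → (ℕ → ℚ) → ℚ
Σ< zero    f = 0ℚ
Σ< (suc n) f = Σ< n f + f n

-- Σ_{j≥1} w_j x_j ; a finite sum since x_j = 0 for j > bound x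
series : (ℕ → ℚ) → ℓ¹ℤ₂ → ℚ
series w x = Σ< (bound x) (λ i → w i * bit (seq x i))

-- weight 1/(j+1) for the paper's index j = i+1
harm : ℕ → ℚ
harm i = + 1 / (suc (suc i))

-- weight 2^{-j} for the paper's index j = i+1
dyad : ℕ → ℚ
dyad zero    = ½
dyad (suc i) = ½ * dyad i

binVal : ℓ¹ℤ₂ → ℚ
binVal = series dyad

-- Points of the plane (rational coordinates suffice: S_j is stable under the
-- affine maps below and their inverses, which preserve ℚ²).
Point : Set
Point = ℚ × ℚ

T₀ : Point → Set
T₀ (x , y) = (0ℚ ≤ x × x ≤ 1ℚ) × (0ℚ ≤ y × y ≤ 1ℚ) × (0ℚ ≤ x + y × x + y ≤ 1ℚ)

S : ℕ → Point → Set
S zero    p = T₀ p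
S (suc j) p = Σ Point λ { (qx , qy) → S j (qx , qy) ×
                ( p ≡ (½ * qx , ½ * qy)
                ⊎ p ≡ (½ * qx + ½ , ½ * qy)
                ⊎ p ≡ (½ * qx , ½ * qy + ½)) }

-- S_T = ⋂_j S_j (restricted to rational points)
InSierpinski : Point → Set
InSierpinski p = ∀ j → S j p

{-# OPTIONS --safe #-}
-- The additivity hypothesis forces x and y to have disjoint supports: bitwise
-- x ⊕ y ≤ x + y with strict inequality wherever both bits are 1, and the
-- weights 1/(j+1) are positive.  For disjoint digit strings the first digits
-- (x₁, y₁) ∈ {(0,0), (1,0), (0,1)} pick one of the three half-size copies of
-- the triangle, and the remaining digits again form a disjoint pair, so by
-- induction on the level j the point (a, b) lies in every S_j.
module Submission where

open import Defs
open import Data.Rational using (_+_)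
open import Data.Product using (_,_)
open import Relation.Binary.PropositionalEquality using (_≡_)

open import Algebra using (CommutativeMonoid)
open import Data.Bool using (Bool; true; false; _xor_; _∧_; _∨_)
open import Data.Bool.Properties using (¬-not)
open import Data.Nat as ℕ using (ℕ; zero; suc; _⊔_; _≤′_; ≤′-refl; ≤′-step)
import Data.Nat.Properties as ℕ
open import Data.Rational using (ℚ; 0ℚ; 1ℚ; ½; _*_; _≤_; _<_; Positive)
open import Data.Rational.Properties
open import Data.Product using (_×_)
open import Data.Sum using (inj₁; inj₂)
open import Function using (_∘_)
open import Relation.Binary.PropositionalEquality using (refl; sym; trans; cong; cong₂; subst; module ≡-Reasoning)
open ≡-Reasoning
open import Relation.Nullary using (¬_; yes; no)
open import Algebra.Properties.CommutativeSemigroup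
  (CommutativeMonoid.commutativeSemigroup +-0-commutativeMonoid) using (interchange)

Σ<-cong : ∀ n {f g : ℕ → ℚ} → (∀ i → f i ≡ g i) → Σ< n f ≡ Σ< n g
Σ<-cong zero    f≗g = refl
Σ<-cong (suc n) f≗g = cong₂ _+_ (Σ<-cong n f≗g) (f≗g n)

Σ<-suc-head : ∀ n (f : ℕ → ℚ) → Σ< (suc n) f ≡ f 0 + Σ< n (f ∘ suc)
Σ<-suc-head zero    f = trans (+-identityˡ (f 0)) (sym (+-identityʳ (f 0)))
Σ<-suc-head (suc n) f = trans (cong (_+ f (suc n)) (Σ<-suc-head n f)) (+-assoc (f 0) _ _)

*-distribˡ-Σ< : ∀ n c (f : ℕ → ℚ) → c * Σ< n f ≡ Σ< n (λ i → c * f i)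
*-distribˡ-Σ< zero    c f = *-zeroʳ c
*-distribˡ-Σ< (suc n) c f = trans (*-distribˡ-+ c _ _) (cong (_+ c * f n) (*-distribˡ-Σ< n c f))

Σ<-distrib-+ : ∀ n (f g : ℕ → ℚ) → Σ< n (λ i → f i + g i) ≡ Σ< n f + Σ< n g
Σ<-distrib-+ zero    f g = refl
Σ<-distrib-+ (suc n) f g =
  trans (cong (_+ (f n + g n)) (Σ<-distrib-+ n f g)) (interchange (Σ< n f) (Σ< n g) (f n) (g n))

Σ<-trailing-zeros : ∀ {m n} (f : ℕ → ℚ) → n ℕ.≤ m → (∀ i → n ℕ.≤ i → f i ≡ 0ℚ) →
                    Σ< m f ≡ Σ< n f
Σ<-trailing-zeros {n = n} f n≤m zeros = go (ℕ.≤⇒≤′ n≤m)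
  where
  go : ∀ {m} → n ≤′ m → Σ< m f ≡ Σ< n f
  go ≤′-refl           = refl
  go (≤′-step {m} n≤m) = trans (cong₂ _+_ (go n≤m) (zeros m (ℕ.≤′⇒≤ n≤m))) (+-identityʳ _)

Σ<-mono-≤ : ∀ n {f g : ℕ → ℚ} → (∀ i → f i ≤ g i) → Σ< n f ≤ Σ< n g
Σ<-mono-≤ zero    f≤g = ≤-refl
Σ<-mono-≤ (suc n) f≤g = +-mono-≤ (Σ<-mono-≤ n f≤g) (f≤g n)

Σ<-mono-< : ∀ n {f g : ℕ → ℚ} → (∀ i → f i ≤ g i) → ∀ {k} → k ℕ.< n → f k < g k →
            Σ< n f < Σ< n g
Σ<-mono-< (suc n) f≤g {k} k<1+n fk<gk with k ℕ.≟ n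
... | yes refl = +-mono-≤-< (Σ<-mono-≤ n f≤g) fk<gk
... | no  k≢n  = +-mono-<-≤ (Σ<-mono-< n f≤g (ℕ.≤∧≢⇒< (ℕ.≤-pred k<1+n) k≢n) fk<gk) (f≤g n)

bit-bounds : ∀ b → 0ℚ ≤ bit b × bit b ≤ 1ℚ
bit-bounds true  = nonNegative⁻¹ 1ℚ , ≤-refl
bit-bounds false = ≤-refl , nonNegative⁻¹ 1ℚ

bit-∨ : ∀ a b → a ∧ b ≡ false → bit a + bit b ≡ bit (a ∨ b)
bit-∨ true  false _ = +-identityʳ 1ℚ
bit-∨ false b     _ = +-identityˡ (bit b)

bit-xor-≤ : ∀ a b → bit (a xor b) ≤ bit a + bit b
bit-xor-≤ true  true  = nonNegative⁻¹ (1ℚ + 1ℚ)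
bit-xor-≤ true  false = ≤-reflexive (sym (+-identityʳ 1ℚ))
bit-xor-≤ false b     = ≤-reflexive (sym (+-identityˡ (bit b)))

bit-xor-< : ∀ a b → a ∧ b ≡ true → bit (a xor b) < bit a + bit b
bit-xor-< true true _ = positive⁻¹ (1ℚ + 1ℚ)

Disjoint : (ℕ → Bool) → (ℕ → Bool) → Set
Disjoint f g = ∀ i → f i ∧ g i ≡ false

weighted : ℕ → (ℕ → ℚ) → (ℕ → Bool) → ℚ
weighted n w f = Σ< n (λ i → w i * bit (f i))

series-≡-weighted : ∀ w x {m} → bound x ℕ.≤ m → series w x ≡ weighted m w (seq x)
series-≡-weighted w x bound≤m = sym (Σ<-trailing-zeros _ bound≤m vanishing)
  where
  vanishing : ∀ i → bound x ℕ.≤ i → w i * bit (seq x i) ≡ 0ℚ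
  vanishing i bound≤i rewrite finite x i bound≤i = *-zeroʳ (w i)

weighted-∨ : ∀ n w {f g} → Disjoint f g →
             weighted n w f + weighted n w g ≡ weighted n w (λ i → f i ∨ g i)
weighted-∨ n w {f} {g} disjoint = trans (sym (Σ<-distrib-+ n _ _)) (Σ<-cong n λ i →
  trans (sym (*-distribˡ-+ (w i) _ _)) (cong (w i *_) (bit-∨ (f i) (g i) (disjoint i))))

weighted-xor-< : ∀ n w {f g} → (∀ i → Positive (w i)) → ∀ {k} → k ℕ.< n → f k ∧ g k ≡ true →
                 weighted n w (λ i → f i xor g i) < weighted n w f + weighted n w g
weighted-xor-< n w {f} {g} w>0 k<n both =
  <-respʳ-≡ (Σ<-distrib-+ n _ _) (Σ<-mono-< n termwise-≤ k<n (termwise-< both))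
  where
  termwise-≤ : ∀ i → w i * bit (f i xor g i) ≤ w i * bit (f i) + w i * bit (g i)
  termwise-≤ i = subst (w i * bit (f i xor g i) ≤_) (*-distribˡ-+ (w i) _ _)
    (*-monoˡ-≤-nonNeg (w i) {{pos⇒nonNeg (w i) {{w>0 i}}}} (bit-xor-≤ (f i) (g i)))
  termwise-< : ∀ {i} → f i ∧ g i ≡ true → w i * bit (f i xor g i) < w i * bit (f i) + w i * bit (g i)
  termwise-< {i} both = <-respʳ-≡ (*-distribˡ-+ (w i) _ _)
    (*-monoʳ-<-pos (w i) {{w>0 i}} (bit-xor-< (f i) (g i) both))

additive⇒disjoint : ∀ w → (∀ i → Positive (w i)) → ∀ x y →
                    series w (x ⊕ y) ≡ series w x + series w y → Disjoint (seq x) (seq y)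
additive⇒disjoint w w>0 x y additive i = ¬-not not-both
  where
  M = bound x ⊔ bound y
  N = M ⊔ suc i
  additive-below-N :
    weighted N w (λ j → seq x j xor seq y j) ≡ weighted N w (seq x) + weighted N w (seq y)
  additive-below-N = begin
    weighted N w (λ j → seq x j xor seq y j)    ≡⟨ series-≡-weighted w (x ⊕ y) (ℕ.m≤m⊔n M (suc i)) ⟨
    series w (x ⊕ y)                            ≡⟨ additive ⟩
    series w x + series w y                     ≡⟨ cong₂ _+_
      (series-≡-weighted w x (ℕ.m≤n⇒m≤n⊔o (suc i) (ℕ.m≤m⊔n (bound x) (bound y))))
      (series-≡-weighted w y (ℕ.m≤n⇒m≤n⊔o (suc i) (ℕ.m≤n⊔m (bound x) (bound y)))) ⟩
    weighted N w (seq x) + weighted N w (seq y) ∎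
  not-both : ¬ (seq x i ∧ seq y i ≡ true)
  not-both both = <-irrefl additive-below-N (weighted-xor-< N w w>0 (ℕ.m≤n⊔m M (suc i)) both)

binary-suc : ∀ n f → weighted (suc n) dyad f ≡ ½ * bit (f 0) + ½ * weighted n dyad (f ∘ suc)
binary-suc n f = begin
  weighted (suc n) dyad f
    ≡⟨ Σ<-suc-head n _ ⟩
  ½ * bit (f 0) + Σ< n (λ i → ½ * dyad i * bit (f (suc i)))
    ≡⟨ cong (½ * bit (f 0) +_) (Σ<-cong n λ i → *-assoc ½ (dyad i) _) ⟩
  ½ * bit (f 0) + Σ< n (λ i → ½ * (dyad i * bit (f (suc i))))
    ≡⟨ cong (½ * bit (f 0) +_) (*-distribˡ-Σ< n ½ _) ⟨
  ½ * bit (f 0) + ½ * weighted n dyad (f ∘ suc)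
    ∎

binary-∈[0,1] : ∀ n f → 0ℚ ≤ weighted n dyad f × weighted n dyad f ≤ 1ℚ
binary-∈[0,1] zero    f = ≤-refl , nonNegative⁻¹ 1ℚ
binary-∈[0,1] (suc n) f =
  subst (λ q → 0ℚ ≤ q × q ≤ 1ℚ) (sym (binary-suc n f))
        (midpoint (bit-bounds (f 0)) (binary-∈[0,1] n (f ∘ suc)))
  where
  ½* : ∀ {p q} → p ≤ q → ½ * p ≤ ½ * q
  ½* = *-monoˡ-≤-nonNeg ½
  midpoint : ∀ {p q} → 0ℚ ≤ p × p ≤ 1ℚ → 0ℚ ≤ q × q ≤ 1ℚ → 0ℚ ≤ ½ * p + ½ * q × ½ * p + ½ * q ≤ 1ℚ
  midpoint (0≤p , p≤1) (0≤q , q≤1) = +-mono-≤ (½* 0≤p) (½* 0≤q) , +-mono-≤ (½* p≤1) (½* q≤1)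

S-step : ∀ j b c → b ∧ c ≡ false → ∀ {qx qy} → S j (qx , qy) →
         S (suc j) (½ * bit b + ½ * qx , ½ * bit c + ½ * qy)
S-step j true  false _ {qx} {qy} s =
  (qx , qy) , s , inj₂ (inj₁ (cong₂ _,_ (+-comm ½ (½ * qx)) (+-identityˡ _)))
S-step j false true  _ {qx} {qy} s =
  (qx , qy) , s , inj₂ (inj₂ (cong₂ _,_ (+-identityˡ _) (+-comm ½ (½ * qy))))
S-step j false false _ {qx} {qy} s =
  (qx , qy) , s , inj₁ (cong₂ _,_ (+-identityˡ _) (+-identityˡ _))

disjoint-binary-∈-S : ∀ j n {f g} → Disjoint f g → S j (weighted n dyad f , weighted n dyad g)
disjoint-binary-∈-S zero n {f} {g} disjoint =
  binary-∈[0,1] n f , binary-∈[0,1] n g ,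
  subst (λ q → 0ℚ ≤ q × q ≤ 1ℚ) (sym (weighted-∨ n dyad disjoint)) (binary-∈[0,1] n _)
disjoint-binary-∈-S (suc j) zero {f} {g} disjoint =
  (0ℚ , 0ℚ) , disjoint-binary-∈-S j zero {f} {g} disjoint , inj₁ refl
disjoint-binary-∈-S (suc j) (suc n) {f} {g} disjoint =
  subst (S (suc j)) (sym (cong₂ _,_ (binary-suc n f) (binary-suc n g)))
        (S-step j (f 0) (g 0) (disjoint 0) (disjoint-binary-∈-S j n (disjoint ∘ suc)))

harm-positive : ∀ i → Positive (harm i)
harm-positive i = normalize-pos 1 (suc (suc i))

theorem3p1 : (x y : ℓ¹ℤ₂) →
    series harm (x ⊕ y) ≡ series harm x + series harm y →
    InSierpinski (binVal x , binVal y)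
theorem3p1 x y additive j =
  subst (S j) (sym (cong₂ _,_ (series-≡-weighted dyad x (ℕ.m≤m⊔n (bound x) (bound y)))
                              (series-≡-weighted dyad y (ℕ.m≤n⊔m (bound x) (bound y)))))
        (disjoint-binary-∈-S j (bound x ⊔ bound y) (additive⇒disjoint harm harm-positive x y additive))
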